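{- Let $X_1=T\rtimes\langle\sigma_1\rangle$ and $X_2=T\rtimes\langle\sigma_2\rangle$ be subgroups of $\mathrm{AGL}(n,p)$, where $T$ is the translation subgroup and $\sigma_1,\sigma_2$ are nontrivial elements of $\mathrm{GL}(n,p)$. Suppose $f:X_1\to X_2$ is a group isomorphism with $f(T)=T$ and $f(\sigma_1)=\sigma_2$. Then there exists $u\in\mathrm{GL}(n,p)$ such that $f$ is the restriction to $X_1$ of the inner automorphism $\mathrm{Inn}(u)$ of $\mathrm{AGL}(n,p)$ induced by $u$. In particular, if $\langle\sigma_1\rangle=\langle\sigma_2\rangle$ (so that this subgroup is fixed by $f$), then $u\in N_{\mathrm{GL}(n,p)}(\langle\sigma_1\rangle)$.
   Context: $\mathrm{AGL}(n,p)=T\rtimes\mathrm{GL}(n,p)$ is the affine group of the $n$-dimensional row space $V(n,p)$ over $\mathbb{F}_p$, $T$ its subgroup of translations. -}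

module Defs where

open import Data.Nat as ℕ using (ℕ; zero; suc; NonZero)
open import Data.Nat.DivMod using (_mod_)
open import Data.Fin using (Fin; toℕ; zero; suc; _≟_)
open import Data.Product using (Σ; ∃; _×_; _,_)
open import Relation.Nullary using (¬_; yes; no)
open import Relation.Binary.PropositionalEquality using (_≡_)

module AGL (p : ℕ) {{nz : NonZero p}} where

  𝔽 : Set
  𝔽 = Fin p

  0𝔽 1𝔽 : 𝔽
  0𝔽 = 0 mod p
  1𝔽 = 1 mod p

  _+𝔽_ _*𝔽_ : 𝔽 → 𝔽 → 𝔽
  a +𝔽 b = (toℕ a ℕ.+ toℕ b) mod p
  a *𝔽 b = (toℕ a ℕ.* toℕ b) mod p

  sum𝔽 : ∀ {m} → (Fin m → 𝔽) → 𝔽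
  sum𝔽 {zero}  f = 0𝔽
  sum𝔽 {suc m} f = f zero +𝔽 sum𝔽 (λ i → f (suc i))

  Vect : ℕ → Set
  Vect n = Fin n → 𝔽

  Mat : ℕ → Set
  Mat n = Fin n → Fin n → 𝔽

  module _ {n : ℕ} where

    0V : Vect n
    0V _ = 0𝔽

    _+V_ : Vect n → Vect n → Vect n
    (v +V w) i = v i +𝔽 w i

    _·M_ : Vect n → Mat n → Vect n
    (v ·M A) j = sum𝔽 (λ i → v i *𝔽 A i j)

    _*M_ : Mat n → Mat n → Mat n
    (A *M B) i j = sum𝔽 (λ k → A i k *𝔽 B k j)

    I : Mat n
    I i j with i ≟ j
    ... | yes _ = 1𝔽
    ... | no  _ = 0𝔽

    _^M_ : Mat n → ℕ → Mat n
    A ^M zero    = I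
    A ^M (suc k) = A *M (A ^M k)

    _≈V_ : Vect n → Vect n → Set
    v ≈V w = ∀ i → v i ≡ w i

    _≈M_ : Mat n → Mat n → Set
    A ≈M B = ∀ i j → A i j ≡ B i j

    IsInverse : Mat n → Mat n → Set
    IsInverse A B = ((A *M B) ≈M I) × ((B *M A) ≈M I)

    IsGL : Mat n → Set
    IsGL A = Σ (Mat n) (λ B → IsInverse A B)

    -- A ∈ ⟨σ⟩ (σ has finite order, so nonnegative powers suffice)
    InCyc : Mat n → Mat n → Set
    InCyc σ A = ∃ λ k → A ≈M (σ ^M k)

  -- Elements of AGL(n,p): pairs (v , A) acting on row vectors by x ↦ x A + v
  -- (the linear part A is required to be invertible where elements are used).
  record Aff (n : ℕ) : Set where
    constructor aff
    field
      tr  : Vect n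
      lin : Mat n
  open Aff public

  module _ {n : ℕ} where

    -- product = composition of maps, acting on the right: x^(g h) = (x^g)^h
    _∙_ : Aff n → Aff n → Aff n
    aff v A ∙ aff w B = aff ((v ·M B) +V w) (A *M B)

    _≈A_ : Aff n → Aff n → Set
    g ≈A h = (tr g ≈V tr h) × (lin g ≈M lin h)

    ι : Mat n → Aff n
    ι A = aff 0V A

    InAGL : Aff n → Set
    InAGL g = IsGL (lin g)

    InT : Aff n → Set
    InT g = lin g ≈M I

    InX : Mat n → Aff n → Set
    InX σ g = InCyc σ (lin g)

    record IsIsoX (σ₁ σ₂ : Mat n) (f : Aff n → Aff n) : Set where
      field
        cong  : ∀ g h → InX σ₁ g → InX σ₁ h → g ≈A h → f g ≈A f h
        into  : ∀ g → InX σ₁ g → InX σ₂ (f g)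
        hom   : ∀ g h → InX σ₁ g → InX σ₁ h → f (g ∙ h) ≈A (f g ∙ f h)
        inj   : ∀ g h → InX σ₁ g → InX σ₁ h → f g ≈A f h → g ≈A h
        surj  : ∀ k → InX σ₂ k → ∃ λ g → InX σ₁ g × (f g ≈A k)

-- On the translation subgroup T ≅ V(n,p), f induces φ v = tr (f (translation v)).
-- Since f is a homomorphism preserving T, φ is additive, hence linear over ℤ/p, so
-- φ v = v U for a matrix U, invertible because f is bijective on T.  Applying f to
-- translation v ∙ σ₁ = σ₁ ∙ translation (v σ₁) gives σ₁ U = U σ₂, hence U⁻¹ σ₁ᵏ U = σ₂ᵏ.
-- Every g ∈ X₁ is σ₁ᵏ followed by the translation by tr g, so f g = σ₂ᵏ ∙ translation (tr g U),
-- which is the conjugate of g by U.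
module Submission where

open import Algebra.Bundles using (CommutativeRing)
open import Algebra.Definitions using
  (Associative; Commutative; LeftIdentity; LeftInverse; _DistributesOverʳ_)
open import Algebra.Structures using (IsCommutativeRing)
open import Algebra.Consequences.Propositional
  using (comm∧idˡ⇒id; comm∧invˡ⇒inv; comm∧distrʳ⇒distrˡ)
open import Data.Fin using (Fin; toℕ; zero; suc; _≟_; punchIn)
open import Data.Fin.Properties using (toℕ-injective; toℕ<n; toℕ-fromℕ<; punchInᵢ≢i)
open import Data.Nat as ℕ using (ℕ; zero; suc; NonZero; _%_)
open import Data.Nat.DivMod using (_mod_; m%n<n; m<n⇒m%n≡m; n%n≡0; m*n%n≡0; %-distribˡ-+; %-distribˡ-*)
import Data.Nat.Properties as ℕ
open import Data.Nat.Primality using (Prime)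
open import Data.Product using (Σ; ∃; _×_; _,_; proj₁; proj₂)
open import Function using (_∘_)
open import Level using (0ℓ)
open import Relation.Binary.Bundles using (Setoid)
import Relation.Binary.Reasoning.Setoid as SetoidReasoning
open import Relation.Binary.PropositionalEquality
open import Relation.Binary.PropositionalEquality.Algebra using (isMagma)
open import Relation.Nullary using (¬_; yes; no; contradiction)

open import Defs

module _ (p : ℕ) {{_ : NonZero p}} where
  open AGL p

  toℕ-mod : ∀ x → toℕ (x mod p) ≡ x % p
  toℕ-mod x = toℕ-fromℕ< (m%n<n x p)

  %≡⇒mod≡ : ∀ {x y} → x % p ≡ y % p → x mod p ≡ y mod p
  %≡⇒mod≡ {x} {y} eq = toℕ-injective (trans (toℕ-mod x) (trans eq (sym (toℕ-mod y))))

  mod-toℕ : ∀ a → toℕ a mod p ≡ a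
  mod-toℕ a = toℕ-injective (trans (toℕ-mod (toℕ a)) (m<n⇒m%n≡m (toℕ<n a)))

  mod-+ : ∀ x y → (x ℕ.+ y) mod p ≡ (x mod p) +𝔽 (y mod p)
  mod-+ x y = %≡⇒mod≡ (trans (%-distribˡ-+ x y p)
    (cong₂ (λ a b → (a ℕ.+ b) % p) (sym (toℕ-mod x)) (sym (toℕ-mod y))))

  mod-* : ∀ x y → (x ℕ.* y) mod p ≡ (x mod p) *𝔽 (y mod p)
  mod-* x y = %≡⇒mod≡ (trans (%-distribˡ-* x y p)
    (cong₂ (λ a b → (a ℕ.* b) % p) (sym (toℕ-mod x)) (sym (toℕ-mod y))))

  infix 25 -𝔽_
  -𝔽_ : 𝔽 → 𝔽
  -𝔽 a = (p ℕ.∸ toℕ a) mod p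

  module _ where
    open ≡-Reasoning

    +𝔽-comm : Commutative _≡_ _+𝔽_
    +𝔽-comm a b = cong (_mod p) (ℕ.+-comm (toℕ a) (toℕ b))

    *𝔽-comm : Commutative _≡_ _*𝔽_
    *𝔽-comm a b = cong (_mod p) (ℕ.*-comm (toℕ a) (toℕ b))

    +𝔽-assoc : Associative _≡_ _+𝔽_
    +𝔽-assoc a b c = begin
      (a +𝔽 b) +𝔽 c                      ≡⟨ cong ((a +𝔽 b) +𝔽_) (mod-toℕ c) ⟨
      (a +𝔽 b) +𝔽 (toℕ c mod p)          ≡⟨ mod-+ (toℕ a ℕ.+ toℕ b) (toℕ c) ⟨
      (toℕ a ℕ.+ toℕ b ℕ.+ toℕ c) mod p   ≡⟨ cong (_mod p) (ℕ.+-assoc (toℕ a) (toℕ b) (toℕ c)) ⟩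
      (toℕ a ℕ.+ (toℕ b ℕ.+ toℕ c)) mod p ≡⟨ mod-+ (toℕ a) (toℕ b ℕ.+ toℕ c) ⟩
      (toℕ a mod p) +𝔽 (b +𝔽 c)          ≡⟨ cong (_+𝔽 (b +𝔽 c)) (mod-toℕ a) ⟩
      a +𝔽 (b +𝔽 c)                      ∎

    *𝔽-assoc : Associative _≡_ _*𝔽_
    *𝔽-assoc a b c = begin
      (a *𝔽 b) *𝔽 c                      ≡⟨ cong ((a *𝔽 b) *𝔽_) (mod-toℕ c) ⟨
      (a *𝔽 b) *𝔽 (toℕ c mod p)          ≡⟨ mod-* (toℕ a ℕ.* toℕ b) (toℕ c) ⟨
      (toℕ a ℕ.* toℕ b ℕ.* toℕ c) mod p   ≡⟨ cong (_mod p) (ℕ.*-assoc (toℕ a) (toℕ b) (toℕ c)) ⟩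
      (toℕ a ℕ.* (toℕ b ℕ.* toℕ c)) mod p ≡⟨ mod-* (toℕ a) (toℕ b ℕ.* toℕ c) ⟩
      (toℕ a mod p) *𝔽 (b *𝔽 c)          ≡⟨ cong (_*𝔽 (b *𝔽 c)) (mod-toℕ a) ⟩
      a *𝔽 (b *𝔽 c)                      ∎

    +𝔽-identityˡ : LeftIdentity _≡_ 0𝔽 _+𝔽_
    +𝔽-identityˡ a = begin
      0𝔽 +𝔽 a             ≡⟨ cong (0𝔽 +𝔽_) (mod-toℕ a) ⟨
      0𝔽 +𝔽 (toℕ a mod p) ≡⟨ mod-+ 0 (toℕ a) ⟨
      toℕ a mod p         ≡⟨ mod-toℕ a ⟩
      a                   ∎

    *𝔽-identityˡ : LeftIdentity _≡_ 1𝔽 _*𝔽_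
    *𝔽-identityˡ a = begin
      1𝔽 *𝔽 a             ≡⟨ cong (1𝔽 *𝔽_) (mod-toℕ a) ⟨
      1𝔽 *𝔽 (toℕ a mod p) ≡⟨ mod-* 1 (toℕ a) ⟨
      (1 ℕ.* toℕ a) mod p ≡⟨ cong (_mod p) (ℕ.*-identityˡ (toℕ a)) ⟩
      toℕ a mod p         ≡⟨ mod-toℕ a ⟩
      a                   ∎

    -𝔽-inverseˡ : LeftInverse _≡_ 0𝔽 -𝔽_ _+𝔽_
    -𝔽-inverseˡ a = begin
      -𝔽 a +𝔽 a                     ≡⟨ cong (-𝔽 a +𝔽_) (mod-toℕ a) ⟨
      -𝔽 a +𝔽 (toℕ a mod p)         ≡⟨ mod-+ (p ℕ.∸ toℕ a) (toℕ a) ⟨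
      (p ℕ.∸ toℕ a ℕ.+ toℕ a) mod p ≡⟨ cong (_mod p) (ℕ.m∸n+n≡m (ℕ.<⇒≤ (toℕ<n a))) ⟩
      p mod p                       ≡⟨ %≡⇒mod≡ (trans (n%n≡0 p) (sym (m*n%n≡0 0 p))) ⟩
      0𝔽                            ∎

    *𝔽-distribʳ-+𝔽 : _DistributesOverʳ_ _≡_ _*𝔽_ _+𝔽_
    *𝔽-distribʳ-+𝔽 c a b = begin
      (a +𝔽 b) *𝔽 c                              ≡⟨ cong ((a +𝔽 b) *𝔽_) (mod-toℕ c) ⟨
      (a +𝔽 b) *𝔽 (toℕ c mod p)                  ≡⟨ mod-* (toℕ a ℕ.+ toℕ b) (toℕ c) ⟨
      ((toℕ a ℕ.+ toℕ b) ℕ.* toℕ c) mod p         ≡⟨ cong (_mod p) (ℕ.*-distribʳ-+ (toℕ c) (toℕ a) (toℕ b)) ⟩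
      (toℕ a ℕ.* toℕ c ℕ.+ toℕ b ℕ.* toℕ c) mod p ≡⟨ mod-+ (toℕ a ℕ.* toℕ c) (toℕ b ℕ.* toℕ c) ⟩
      (a *𝔽 c) +𝔽 (b *𝔽 c)                        ∎

  𝔽-isCommutativeRing : IsCommutativeRing _≡_ _+𝔽_ _*𝔽_ -𝔽_ 0𝔽 1𝔽
  𝔽-isCommutativeRing = record
    { isRing = record
      { +-isAbelianGroup = record
        { isGroup = record
          { isMonoid = record
            { isSemigroup = record { isMagma = isMagma _+𝔽_ ; assoc = +𝔽-assoc }
            ; identity    = comm∧idˡ⇒id +𝔽-comm +𝔽-identityˡ
            }
          ; inverse = comm∧invˡ⇒inv +𝔽-comm -𝔽-inverseˡ
          ; ⁻¹-cong = cong -𝔽_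
          }
        ; comm = +𝔽-comm
        }
      ; *-cong     = cong₂ _*𝔽_
      ; *-assoc    = *𝔽-assoc
      ; *-identity = comm∧idˡ⇒id *𝔽-comm *𝔽-identityˡ
      ; distrib    = comm∧distrʳ⇒distrˡ *𝔽-comm *𝔽-distribʳ-+𝔽 , *𝔽-distribʳ-+𝔽
      }
    ; *-comm = *𝔽-comm
    }

  𝔽-commutativeRing : CommutativeRing 0ℓ 0ℓ
  𝔽-commutativeRing = record { isCommutativeRing = 𝔽-isCommutativeRing }

  open CommutativeRing 𝔽-commutativeRing
    using (semiring; +-group; +-identityˡ; +-identityʳ; *-identityˡ; *-identityʳ; zeroˡ; zeroʳ; distribʳ)
  open import Algebra.Properties.Semiring.Sum semiring
    using (sum; sum-cong-≗; sum-remove; sum-replicate-zero; ∑-comm; *-distribˡ-sum; *-distribʳ-sum)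
  open import Algebra.Properties.Group +-group using (identityˡ-unique)

  sum𝔽≡sum : ∀ {m} (f : Fin m → 𝔽) → sum𝔽 f ≡ sum f
  sum𝔽≡sum {zero}  f = refl
  sum𝔽≡sum {suc m} f = cong (f zero +𝔽_) (sum𝔽≡sum (f ∘ suc))

  sum𝔽-cong : ∀ {m} {f g : Fin m → 𝔽} → (∀ i → f i ≡ g i) → sum𝔽 f ≡ sum𝔽 g
  sum𝔽-cong {f = f} {g} f≗g = trans (sum𝔽≡sum f) (trans (sum-cong-≗ f≗g) (sym (sum𝔽≡sum g)))

  ·M-as-sum : ∀ {n} (x : Vect n) (A : Mat n) j → (x ·M A) j ≡ sum (λ i → x i *𝔽 A i j)
  ·M-as-sum x A j = sum𝔽≡sum (λ i → x i *𝔽 A i j)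

  sum-zero : ∀ {m} {f : Fin m → 𝔽} → (∀ i → f i ≡ 0𝔽) → sum f ≡ 0𝔽
  sum-zero {m} f≗0 = trans (sum-cong-≗ f≗0) (sum-replicate-zero m)

  sum-δ : ∀ {m} (f : Fin m → 𝔽) i → (∀ k → k ≢ i → f k ≡ 0𝔽) → sum f ≡ f i
  sum-δ {suc m} f i f-vanishes = begin
    sum f                         ≡⟨ sum-remove f ⟩
    f i +𝔽 sum (f ∘ punchIn i)    ≡⟨ cong (f i +𝔽_) (sum-zero (λ k → f-vanishes _ (punchInᵢ≢i i k))) ⟩
    f i +𝔽 0𝔽                     ≡⟨ +-identityʳ (f i) ⟩
    f i                           ∎
    where open ≡-Reasoning

  I-diag : ∀ {n} (i : Fin n) → I i i ≡ 1𝔽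
  I-diag i with i ≟ i
  ... | yes _   = refl
  ... | no i≢i = contradiction refl i≢i

  I-offdiag : ∀ {n} {i j : Fin n} → i ≢ j → I i j ≡ 0𝔽
  I-offdiag {i = i} {j} i≢j with i ≟ j
  ... | yes i≡j = contradiction i≡j i≢j
  ... | no _    = refl

  module _ {n : ℕ} where

    Vect-setoid : Setoid 0ℓ 0ℓ
    Vect-setoid = record
      { Carrier       = Vect n
      ; _≈_           = _≈V_
      ; isEquivalence = record
        { refl  = λ _ → refl
        ; sym   = λ v≈w i → sym (v≈w i)
        ; trans = λ u≈v v≈w i → trans (u≈v i) (v≈w i)
        }
      }

    Mat-setoid : Setoid 0ℓ 0ℓ
    Mat-setoid = record
      { Carrier       = Mat n
      ; _≈_           = _≈M_
      ; isEquivalence = record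
        { refl  = λ _ _ → refl
        ; sym   = λ A≈B i j → sym (A≈B i j)
        ; trans = λ A≈B B≈C i j → trans (A≈B i j) (B≈C i j)
        }
      }

    Aff-setoid : Setoid 0ℓ 0ℓ
    Aff-setoid = record
      { Carrier       = Aff n
      ; _≈_           = _≈A_
      ; isEquivalence = record
        { refl  = V.refl , M.refl
        ; sym   = λ (v≈w , A≈B) → V.sym v≈w , M.sym A≈B
        ; trans = λ (u≈v , A≈B) (v≈w , B≈C) → V.trans u≈v v≈w , M.trans A≈B B≈C
        }
      }
      where
      module V = Setoid Vect-setoid
      module M = Setoid Mat-setoid

  module ≈V {n} = Setoid (Vect-setoid {n})
  module ≈M {n} = Setoid (Mat-setoid {n})
  module ≈A {n} = Setoid (Aff-setoid {n})

  module _ {n : ℕ} where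

    ·M-cong : ∀ {x y : Vect n} {A B} → x ≈V y → A ≈M B → (x ·M A) ≈V (y ·M B)
    ·M-cong x≈y A≈B j = sum𝔽-cong (λ i → cong₂ _*𝔽_ (x≈y i) (A≈B i j))

    *M-cong : ∀ {A A′ B B′ : Mat n} → A ≈M A′ → B ≈M B′ → (A *M B) ≈M (A′ *M B′)
    *M-cong A≈A′ B≈B′ i = ·M-cong (A≈A′ i) B≈B′

    ·M-identityʳ : (v : Vect n) → (v ·M I) ≈V v
    ·M-identityʳ v j = begin
      (v ·M I) j                ≡⟨ ·M-as-sum v I j ⟩
      sum (λ i → v i *𝔽 I i j)  ≡⟨ sum-δ _ j (λ i i≢j → trans (cong (v i *𝔽_) (I-offdiag i≢j)) (zeroʳ (v i))) ⟩
      v j *𝔽 I j j              ≡⟨ cong (v j *𝔽_) (I-diag j) ⟩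
      v j *𝔽 1𝔽                 ≡⟨ *-identityʳ (v j) ⟩
      v j                       ∎
      where open ≡-Reasoning

    *M-identityˡ : (A : Mat n) → (I *M A) ≈M A
    *M-identityˡ A i j = begin
      (I *M A) i j                ≡⟨ ·M-as-sum (I i) A j ⟩
      sum (λ k → I i k *𝔽 A k j)  ≡⟨ sum-δ _ i (λ k k≢i → trans (cong (_*𝔽 A k j) (I-offdiag (k≢i ∘ sym))) (zeroˡ (A k j))) ⟩
      I i i *𝔽 A i j              ≡⟨ cong (_*𝔽 A i j) (I-diag i) ⟩
      1𝔽 *𝔽 A i j                 ≡⟨ *-identityˡ (A i j) ⟩
      A i j                       ∎
      where open ≡-Reasoning

    *M-identityʳ : (A : Mat n) → (A *M I) ≈M A
    *M-identityʳ A i = ·M-identityʳ (A i)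

    0V-·M : (A : Mat n) → (0V ·M A) ≈V 0V
    0V-·M A j = trans (·M-as-sum 0V A j) (sum-zero (λ i → zeroˡ (A i j)))

    ·M-assoc : (x : Vect n) (A B : Mat n) → ((x ·M A) ·M B) ≈V (x ·M (A *M B))
    ·M-assoc x A B j = begin
      ((x ·M A) ·M B) j                                 ≡⟨ ·M-as-sum (x ·M A) B j ⟩
      sum (λ k → (x ·M A) k *𝔽 B k j)                   ≡⟨ sum-cong-≗ distribute-B ⟩
      sum (λ k → sum (λ i → (x i *𝔽 A i k) *𝔽 B k j))   ≡⟨ ∑-comm (λ k i → (x i *𝔽 A i k) *𝔽 B k j) ⟩
      sum (λ i → sum (λ k → (x i *𝔽 A i k) *𝔽 B k j))   ≡⟨ sum-cong-≗ factor-x ⟩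
      sum (λ i → x i *𝔽 (A *M B) i j)                   ≡⟨ ·M-as-sum x (A *M B) j ⟨
      (x ·M (A *M B)) j                                 ∎
      where
      open ≡-Reasoning
      distribute-B : ∀ k → (x ·M A) k *𝔽 B k j ≡ sum (λ i → (x i *𝔽 A i k) *𝔽 B k j)
      distribute-B k = trans (cong (_*𝔽 B k j) (·M-as-sum x A k)) (*-distribʳ-sum (B k j) (λ i → x i *𝔽 A i k))
      factor-x : ∀ i → sum (λ k → (x i *𝔽 A i k) *𝔽 B k j) ≡ x i *𝔽 (A *M B) i j
      factor-x i = begin
        sum (λ k → (x i *𝔽 A i k) *𝔽 B k j)  ≡⟨ sum-cong-≗ (λ k → *𝔽-assoc (x i) (A i k) (B k j)) ⟩
        sum (λ k → x i *𝔽 (A i k *𝔽 B k j))  ≡⟨ *-distribˡ-sum (x i) (λ k → A i k *𝔽 B k j) ⟨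
        x i *𝔽 sum (λ k → A i k *𝔽 B k j)    ≡⟨ cong (x i *𝔽_) (·M-as-sum (A i) B j) ⟨
        x i *𝔽 (A *M B) i j                   ∎

    *M-assoc : (A B C : Mat n) → ((A *M B) *M C) ≈M (A *M (B *M C))
    *M-assoc A B C i = ·M-assoc (A i) B C

    infixr 6 _•_
    _•_ : 𝔽 → Vect n → Vect n
    (c • v) j = c *𝔽 v j

    module AdditiveMap (φ : Vect n → Vect n)
                       (φ-cong : ∀ {v w} → v ≈V w → φ v ≈V φ w)
                       (φ-+ : ∀ v w → φ (v +V w) ≈V (φ v +V φ w)) where

      φ-0V : φ 0V ≈V 0V
      φ-0V j = identityˡ-unique (φ 0V j) (φ 0V j)
        (sym (trans (φ-cong (λ _ → sym (+-identityʳ 0𝔽)) j) (φ-+ 0V 0V j)))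

      •-suc : ∀ k v → (suc k mod p • v) ≈V (v +V (k mod p • v))
      •-suc k v j = begin
        (suc k mod p) *𝔽 v j                   ≡⟨ cong (_*𝔽 v j) (mod-+ 1 k) ⟩
        (1𝔽 +𝔽 (k mod p)) *𝔽 v j              ≡⟨ distribʳ (v j) 1𝔽 (k mod p) ⟩
        (1𝔽 *𝔽 v j) +𝔽 ((k mod p) *𝔽 v j)     ≡⟨ cong (_+𝔽 ((k mod p) *𝔽 v j)) (*-identityˡ (v j)) ⟩
        v j +𝔽 ((k mod p) *𝔽 v j)             ∎
        where open ≡-Reasoning

      -- Over ℤ/p every scalar is a sum of ones, so additivity already gives linearity.
      φ-•-mod : ∀ k v → φ (k mod p • v) ≈V (k mod p • φ v)
      φ-•-mod zero v j = begin
        φ (0𝔽 • v) j    ≡⟨ φ-cong (λ i → zeroˡ (v i)) j ⟩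
        φ 0V j          ≡⟨ φ-0V j ⟩
        0𝔽              ≡⟨ zeroˡ (φ v j) ⟨
        (0𝔽 • φ v) j    ∎
        where open ≡-Reasoning
      φ-•-mod (suc k) v j = begin
        φ (suc k mod p • v) j               ≡⟨ φ-cong (•-suc k v) j ⟩
        φ (v +V (k mod p • v)) j            ≡⟨ φ-+ v (k mod p • v) j ⟩
        φ v j +𝔽 φ (k mod p • v) j          ≡⟨ cong (φ v j +𝔽_) (φ-•-mod k v j) ⟩
        φ v j +𝔽 (k mod p • φ v) j          ≡⟨ •-suc k (φ v) j ⟨
        (suc k mod p • φ v) j               ∎
        where open ≡-Reasoning

      φ-• : ∀ c v → φ (c • v) ≈V (c • φ v)
      φ-• c v j = begin
        φ (c • v) j                ≡⟨ φ-cong (λ i → cong (_*𝔽 v i) (mod-toℕ c)) j ⟨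
        φ (toℕ c mod p • v) j      ≡⟨ φ-•-mod (toℕ c) v j ⟩
        (toℕ c mod p • φ v) j      ≡⟨ cong (_*𝔽 φ v j) (mod-toℕ c) ⟩
        (c • φ v) j                ∎
        where open ≡-Reasoning

      φ-sum : ∀ {m} (F : Fin m → Vect n) →
              φ (λ j → sum𝔽 (λ i → F i j)) ≈V (λ j → sum𝔽 (λ i → φ (F i) j))
      φ-sum {zero}  F = φ-0V
      φ-sum {suc m} F j = trans (φ-+ (F zero) (λ j → sum𝔽 (λ i → F (suc i) j)) j)
                                (cong (φ (F zero) j +𝔽_) (φ-sum (F ∘ suc) j))

      matrix : Mat n
      matrix i = φ (I i)

      φ≈·M-matrix : ∀ v → φ v ≈V (v ·M matrix)
      φ≈·M-matrix v j = begin
        φ v j                                 ≡⟨ φ-cong (·M-identityʳ v) j ⟨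
        φ (λ j → sum𝔽 (λ i → (v i • I i) j)) j ≡⟨ φ-sum (λ i → v i • I i) j ⟩
        sum𝔽 (λ i → φ (v i • I i) j)          ≡⟨ sum𝔽-cong (λ i → φ-• (v i) (I i) j) ⟩
        (v ·M matrix) j                       ∎
        where open ≡-Reasoning

    ·M-bijective⇒invertible : (U : Mat n)
      → (∀ {v w} → (v ·M U) ≈V (w ·M U) → v ≈V w)
      → (∀ w → ∃ λ v → (v ·M U) ≈V w)
      → Σ (Mat n) (IsInverse U)
    ·M-bijective⇒invertible U injective surjective = W , UW≈I , WU≈I
      where
      W : Mat n
      W i = proj₁ (surjective (I i))

      WU≈I : (W *M U) ≈M I
      WU≈I i = proj₂ (surjective (I i))

      UW≈I : (U *M W) ≈M I
      UW≈I i = injective (begin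
        (U i ·M W) ·M U   ≈⟨ ·M-assoc (U i) W U ⟩
        U i ·M (W *M U)   ≈⟨ ·M-cong (≈V.refl {x = U i}) WU≈I ⟩
        U i ·M I          ≈⟨ ·M-identityʳ (U i) ⟩
        U i               ≈⟨ *M-identityˡ U i ⟨
        I i ·M U          ∎)
        where open SetoidReasoning Vect-setoid

    ^M-intertwine : ∀ {A B U : Mat n} → (A *M U) ≈M (U *M B)
                  → ∀ k → ((A ^M k) *M U) ≈M (U *M (B ^M k))
    ^M-intertwine {A} {B} {U} AU≈UB zero = ≈M.trans (*M-identityˡ U) (≈M.sym (*M-identityʳ U))
    ^M-intertwine {A} {B} {U} AU≈UB (suc k) = begin
      (A *M (A ^M k)) *M U   ≈⟨ *M-assoc A (A ^M k) U ⟩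
      A *M ((A ^M k) *M U)   ≈⟨ *M-cong (≈M.refl {x = A}) (^M-intertwine {A} {B} {U} AU≈UB k) ⟩
      A *M (U *M (B ^M k))   ≈⟨ *M-assoc A U (B ^M k) ⟨
      (A *M U) *M (B ^M k)   ≈⟨ *M-cong AU≈UB ≈M.refl ⟩
      (U *M B) *M (B ^M k)   ≈⟨ *M-assoc U B (B ^M k) ⟩
      U *M (B *M (B ^M k))   ∎
      where open SetoidReasoning Mat-setoid

    ^M-conjugate : ∀ {A B U W : Mat n} → (W *M U) ≈M I → (A *M U) ≈M (U *M B)
                 → ∀ k → ((W *M (A ^M k)) *M U) ≈M (B ^M k)
    ^M-conjugate {A} {B} {U} {W} WU≈I AU≈UB k = begin
      (W *M (A ^M k)) *M U   ≈⟨ *M-assoc W (A ^M k) U ⟩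
      W *M ((A ^M k) *M U)   ≈⟨ *M-cong (≈M.refl {x = W}) (^M-intertwine {A} {B} {U} AU≈UB k) ⟩
      W *M (U *M (B ^M k))   ≈⟨ *M-assoc W U (B ^M k) ⟨
      (W *M U) *M (B ^M k)   ≈⟨ *M-cong WU≈I ≈M.refl ⟩
      I *M (B ^M k)          ≈⟨ *M-identityˡ (B ^M k) ⟩
      B ^M k                 ∎
      where open SetoidReasoning Mat-setoid

  module _ {n : ℕ} where

    translation : Vect n → Aff n
    translation v = aff v I

    ∙-cong : ∀ {g g′ h h′ : Aff n} → g ≈A g′ → h ≈A h′ → (g ∙ h) ≈A (g′ ∙ h′)
    ∙-cong (v≈v′ , A≈A′) (w≈w′ , B≈B′) =
      (λ j → cong₂ _+𝔽_ (·M-cong v≈v′ B≈B′ j) (w≈w′ j)) , *M-cong A≈A′ B≈B′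

    ι-∙-ι : ∀ (A B : Mat n) → (ι A ∙ ι B) ≈A ι (A *M B)
    ι-∙-ι A B = (λ j → trans (+-identityʳ _) (0V-·M B j)) , ≈M.refl

    translation-∙-translation : ∀ (v w : Vect n) → (translation v ∙ translation w) ≈A translation (v +V w)
    translation-∙-translation v w = (λ j → cong (_+𝔽 w j) (·M-identityʳ v j)) , *M-identityˡ I

    ι-∙-translation : ∀ (A : Mat n) v → (ι A ∙ translation v) ≈A aff v A
    ι-∙-translation A v =
      (λ j → trans (cong (_+𝔽 v j) (0V-·M I j)) (+-identityˡ (v j))) , *M-identityʳ A

    translation-∙-ι : ∀ (v : Vect n) A → (translation v ∙ ι A) ≈A aff (v ·M A) A
    translation-∙-ι v A = (λ j → +-identityʳ _) , *M-identityˡ A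

    ι-conjugate : ∀ (W U : Mat n) g → ((ι W ∙ g) ∙ ι U) ≈A aff (tr g ·M U) ((W *M lin g) *M U)
    ι-conjugate W U g = (λ j → trans (+-identityʳ _) (·M-cong tr-ι∙g (≈M.refl {x = U}) j)) , ≈M.refl
      where
      tr-ι∙g : ((0V ·M lin g) +V tr g) ≈V tr g
      tr-ι∙g i = trans (cong (_+𝔽 tr g i) (0V-·M (lin g) i)) (+-identityˡ (tr g i))

  module Rigidity {n : ℕ} (σ₁ σ₂ : Mat n) (f : Aff n → Aff n) (f-iso : IsIsoX σ₁ σ₂ f)
                  (f-T : ∀ g → InT g → InT (f g))
                  (f-T-onto : ∀ k → InT k → ∃ λ g → InT g × (f g ≈A k))
                  (f-σ₁ : f (ι σ₁) ≈A ι σ₂) where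
    open IsIsoX f-iso renaming (cong to f-cong)

    translation∈X : ∀ v → InX σ₁ (translation v)
    translation∈X v = 0 , ≈M.refl

    ι-σ₁∈X : InX σ₁ (ι σ₁)
    ι-σ₁∈X = 1 , ≈M.sym (*M-identityʳ σ₁)

    φ : Vect n → Vect n
    φ v = tr (f (translation v))

    f-translation : ∀ v → f (translation v) ≈A translation (φ v)
    f-translation v = ≈V.refl , f-T (translation v) ≈M.refl

    φ-cong : ∀ {v w} → v ≈V w → φ v ≈V φ w
    φ-cong {v} {w} v≈w =
      proj₁ (f-cong (translation v) (translation w) (translation∈X v) (translation∈X w) (v≈w , ≈M.refl))

    φ-+ : ∀ v w → φ (v +V w) ≈V (φ v +V φ w)
    φ-+ v w = proj₁ (begin
      f (translation (v +V w))               ≈⟨ f-cong _ _ (translation∈X (v +V w)) (0 , *M-identityˡ I)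
                                                   (≈A.sym (translation-∙-translation v w)) ⟩
      f (translation v ∙ translation w)      ≈⟨ hom _ _ (translation∈X v) (translation∈X w) ⟩
      f (translation v) ∙ f (translation w)  ≈⟨ ∙-cong (f-translation v) (f-translation w) ⟩
      translation (φ v) ∙ translation (φ w)  ≈⟨ translation-∙-translation (φ v) (φ w) ⟩
      translation (φ v +V φ w)               ∎)
      where open SetoidReasoning Aff-setoid

    open AdditiveMap φ φ-cong φ-+ public using (φ-0V; φ≈·M-matrix) renaming (matrix to U)

    φ-injective : ∀ {v w} → φ v ≈V φ w → v ≈V w
    φ-injective {v} {w} φv≈φw = proj₁ (inj (translation v) (translation w) (translation∈X v) (translation∈X w)
      (≈A.trans (f-translation v) (≈A.trans (φv≈φw , ≈M.refl) (≈A.sym (f-translation w)))))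

    φ-surjective : ∀ w → ∃ λ v → φ v ≈V w
    φ-surjective w =
      let (g , g∈T , fg≈w) = f-T-onto (translation w) ≈M.refl
          g≈translation = ≈V.refl , ≈M.sym g∈T
      in tr g , proj₁ (≈A.trans (f-cong _ _ (translation∈X (tr g)) (0 , g∈T) g≈translation) fg≈w)

    U-inverse : Σ (Mat n) (IsInverse U)
    U-inverse = ·M-bijective⇒invertible U
      (λ {v} {w} vU≈wU → φ-injective (≈V.trans (φ≈·M-matrix v) (≈V.trans vU≈wU (≈V.sym (φ≈·M-matrix w)))))
      (λ w → let (v , φv≈w) = φ-surjective w in v , ≈V.trans (≈V.sym (φ≈·M-matrix v)) φv≈w)

    W : Mat n
    W = proj₁ U-inverse

    φ-σ : ∀ v → φ (v ·M σ₁) ≈V (φ v ·M σ₂)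
    φ-σ v = proj₁ (begin
      aff (φ (v ·M σ₁)) σ₂                  ≈⟨ ι-∙-translation σ₂ (φ (v ·M σ₁)) ⟨
      ι σ₂ ∙ translation (φ (v ·M σ₁))      ≈⟨ ∙-cong f-σ₁ (f-translation (v ·M σ₁)) ⟨
      f (ι σ₁) ∙ f (translation (v ·M σ₁))  ≈⟨ hom _ _ ι-σ₁∈X (translation∈X (v ·M σ₁)) ⟨
      f (ι σ₁ ∙ translation (v ·M σ₁))      ≈⟨ f-cong _ _ (1 , ≈M.refl) (1 , *M-swap) swap ⟩
      f (translation v ∙ ι σ₁)              ≈⟨ hom _ _ (translation∈X v) ι-σ₁∈X ⟩
      f (translation v) ∙ f (ι σ₁)          ≈⟨ ∙-cong (f-translation v) f-σ₁ ⟩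
      translation (φ v) ∙ ι σ₂              ≈⟨ translation-∙-ι (φ v) σ₂ ⟩
      aff (φ v ·M σ₂) σ₂                    ∎)
      where
      open SetoidReasoning Aff-setoid
      *M-swap : (I *M σ₁) ≈M (σ₁ *M I)
      *M-swap = ≈M.trans (*M-identityˡ σ₁) (≈M.sym (*M-identityʳ σ₁))
      swap : (ι σ₁ ∙ translation (v ·M σ₁)) ≈A (translation v ∙ ι σ₁)
      swap = ≈A.trans (ι-∙-translation σ₁ (v ·M σ₁)) (≈A.sym (translation-∙-ι v σ₁))

    U-intertwines : (σ₁ *M U) ≈M (U *M σ₂)
    U-intertwines i = begin
      σ₁ i ·M U        ≈⟨ φ≈·M-matrix (σ₁ i) ⟨
      φ (σ₁ i)         ≈⟨ φ-cong (*M-identityˡ σ₁ i) ⟨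
      φ (I i ·M σ₁)    ≈⟨ φ-σ (I i) ⟩
      φ (I i) ·M σ₂    ∎
      where open SetoidReasoning Vect-setoid

    f-ι-^M : ∀ k → f (ι (σ₁ ^M k)) ≈A ι (σ₂ ^M k)
    f-ι-^M zero = ≈A.trans (f-translation 0V) (φ-0V , ≈M.refl)
    f-ι-^M (suc k) = begin
      f (ι (σ₁ ^M suc k))          ≈⟨ f-cong _ _ (suc k , ≈M.refl) (suc k , ≈M.refl) (≈A.sym (ι-∙-ι σ₁ (σ₁ ^M k))) ⟩
      f (ι σ₁ ∙ ι (σ₁ ^M k))       ≈⟨ hom _ _ ι-σ₁∈X (k , ≈M.refl) ⟩
      f (ι σ₁) ∙ f (ι (σ₁ ^M k))   ≈⟨ ∙-cong f-σ₁ (f-ι-^M k) ⟩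
      ι σ₂ ∙ ι (σ₂ ^M k)           ≈⟨ ι-∙-ι σ₂ (σ₂ ^M k) ⟩
      ι (σ₂ ^M suc k)              ∎
      where open SetoidReasoning Aff-setoid

    conjugate-^M : ∀ k → ((W *M (σ₁ ^M k)) *M U) ≈M (σ₂ ^M k)
    conjugate-^M = ^M-conjugate {A = σ₁} {B = σ₂} {U = U} {W = W} (proj₂ (proj₂ U-inverse)) U-intertwines

    f≈conjugation : ∀ g → InX σ₁ g → f g ≈A ((ι W ∙ g) ∙ ι U)
    f≈conjugation g (k , lin-g≈σ₁^k) = begin
      f g                                        ≈⟨ f-cong _ _ (k , lin-g≈σ₁^k) (k , *M-identityʳ (σ₁ ^M k)) split ⟩
      f (ι (σ₁ ^M k) ∙ translation (tr g))       ≈⟨ hom _ _ (k , ≈M.refl) (translation∈X (tr g)) ⟩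
      f (ι (σ₁ ^M k)) ∙ f (translation (tr g))   ≈⟨ ∙-cong (f-ι-^M k) (f-translation (tr g)) ⟩
      ι (σ₂ ^M k) ∙ translation (φ (tr g))       ≈⟨ ι-∙-translation (σ₂ ^M k) (φ (tr g)) ⟩
      aff (φ (tr g)) (σ₂ ^M k)                   ≈⟨ φ≈·M-matrix (tr g) , ≈M.sym conj-lin-g ⟩
      aff (tr g ·M U) ((W *M lin g) *M U)        ≈⟨ ι-conjugate W U g ⟨
      (ι W ∙ g) ∙ ι U                            ∎
      where
      open SetoidReasoning Aff-setoid
      split : g ≈A (ι (σ₁ ^M k) ∙ translation (tr g))
      split = ≈A.trans (≈V.refl , lin-g≈σ₁^k) (≈A.sym (ι-∙-translation (σ₁ ^M k) (tr g)))
      conj-lin-g : ((W *M lin g) *M U) ≈M (σ₂ ^M k)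
      conj-lin-g = ≈M.trans (*M-cong (*M-cong (≈M.refl {x = W}) lin-g≈σ₁^k) (≈M.refl {x = U})) (conjugate-^M k)

    conjugate-⟨σ₁⟩⊆⟨σ₂⟩ : ∀ A → InCyc σ₁ A → InCyc σ₂ ((W *M A) *M U)
    conjugate-⟨σ₁⟩⊆⟨σ₂⟩ A (k , A≈σ₁^k) =
      k , ≈M.trans (*M-cong (*M-cong (≈M.refl {x = W}) A≈σ₁^k) (≈M.refl {x = U})) (conjugate-^M k)

    ⟨σ₂⟩⊆conjugate-⟨σ₁⟩ : ∀ A → InCyc σ₂ A → ∃ λ B → InCyc σ₁ B × ((W *M B) *M U) ≈M A
    ⟨σ₂⟩⊆conjugate-⟨σ₁⟩ A (k , A≈σ₂^k) = σ₁ ^M k , (k , ≈M.refl) , ≈M.trans (conjugate-^M k) (≈M.sym A≈σ₂^k)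

open AGL

lemma2p6 : (p : ℕ) {{nz : NonZero p}} → Prime p → (n : ℕ)
    → (σ₁ σ₂ : Mat p n)
    → IsGL p σ₁ → IsGL p σ₂
    → ¬ (_≈M_ p σ₁ (I p)) → ¬ (_≈M_ p σ₂ (I p))
    → (f : Aff p n → Aff p n)
    → IsIsoX p σ₁ σ₂ f
    → (∀ g → InT p g → InT p (f g))
    → (∀ k → InT p k → ∃ λ g → InT p g × _≈A_ p (f g) k)
    → _≈A_ p (f (ι p σ₁)) (ι p σ₂)
    → Σ (Mat p n) λ u → Σ (Mat p n) λ u⁻¹ → IsInverse p u u⁻¹
        × (∀ g → InX p σ₁ g
             → _≈A_ p (f g) (_∙_ p (_∙_ p (ι p u⁻¹) g) (ι p u)))
        × ((∀ A → InCyc p σ₁ A → InCyc p σ₂ A)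
           → (∀ A → InCyc p σ₂ A → InCyc p σ₁ A)
           → (∀ A → InCyc p σ₁ A → InCyc p σ₁ (_*M_ p (_*M_ p u⁻¹ A) u))
             × (∀ A → InCyc p σ₁ A
                  → ∃ λ B → InCyc p σ₁ B × _≈M_ p (_*M_ p (_*M_ p u⁻¹ B) u) A))
lemma2p6 p _ n σ₁ σ₂ _ _ _ _ f f-iso f-T f-T-onto f-σ₁ =
  U , W , proj₂ U-inverse , f≈conjugation , λ ⟨σ₁⟩⊆⟨σ₂⟩ ⟨σ₂⟩⊆⟨σ₁⟩ →
      (λ A A∈⟨σ₁⟩ → ⟨σ₂⟩⊆⟨σ₁⟩ _ (conjugate-⟨σ₁⟩⊆⟨σ₂⟩ A A∈⟨σ₁⟩))
    , (λ A A∈⟨σ₁⟩ → ⟨σ₂⟩⊆conjugate-⟨σ₁⟩ A (⟨σ₁⟩⊆⟨σ₂⟩ A A∈⟨σ₁⟩))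
  where open Rigidity p σ₁ σ₂ f f-iso f-T f-T-onto f-σ₁
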